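{- The Petersen graph $G(5,2)$ is a monoid graph.
   Context: $G(n,k)$ ($0<k<n/2$) has vertices $u_0,\dots,u_{n-1},v_0,\dots,v_{n-1}$ and edges $u_iu_{i+1}$, $v_iv_{i+k}$, $u_iv_i$ (indices mod $n$). For a semigroup $S$ and $C\subseteq S$, the Cayley graph $\mathrm{Cay}(S,C)$ is the directed multigraph (loops allowed) with vertex set $S$ and one arc $(s,sc)$ for each $s\in S$, $c\in C$. Its underlying graph is obtained by deleting loops, forgetting orientations and merging parallel edges. A graph is a monoid graph if it is isomorphic to the underlying graph of $\mathrm{Cay}(M,C)$ for some monoid $M$ and some $C\subseteq M$. -}

module Defs where

open import Level using (Level; _⊔_; 0ℓ)
open import Data.Nat using (ℕ; NonZero; _+_; _%_)
open import Data.Fin using (Fin; toℕ)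
open import Data.Sum using (_⊎_; inj₁; inj₂)
open import Data.Product using (_×_; ∃-syntax; Σ)
open import Data.Empty using (⊥)
open import Relation.Nullary using (¬_)
open import Relation.Unary using (Pred; _∈_)
open import Relation.Binary.PropositionalEquality as ≡ using (_≡_)
open import Algebra.Bundles using (Monoid)
open import Function.Bundles using (Bijection; _⇔_)

-- Generalized Petersen graph G(n,k): vertices u_i = inj₁ i, v_i = inj₂ i.
GPVertex : ℕ → Set
GPVertex n = Fin n ⊎ Fin n

-- Adjacency (symmetric, loopless for 0 < k < n/2, n ≥ 3):
-- edges u_i u_{i+1}, v_i v_{i+k}, u_i v_i, indices mod n.
GPAdj : (n k : ℕ) → .{{_ : NonZero n}} → GPVertex n → GPVertex n → Set
GPAdj n k (inj₁ i) (inj₁ j) =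
  (toℕ j ≡ (toℕ i + 1) % n) ⊎ (toℕ i ≡ (toℕ j + 1) % n)
GPAdj n k (inj₂ i) (inj₂ j) =
  (toℕ j ≡ (toℕ i + k) % n) ⊎ (toℕ i ≡ (toℕ j + k) % n)
GPAdj n k (inj₁ i) (inj₂ j) = i ≡ j
GPAdj n k (inj₂ i) (inj₁ j) = i ≡ j

CayUAdj : ∀ {c ℓ ℓ′} (M : Monoid c ℓ) (C : Pred (Monoid.Carrier M) ℓ′) →
          Monoid.Carrier M → Monoid.Carrier M → Set (c ⊔ ℓ ⊔ ℓ′)
CayUAdj M C s t =
  ¬ (s ≈ t) ×
  ((∃[ x ] (x ∈ C × t ≈ s ∙ x)) ⊎ (∃[ x ] (x ∈ C × s ≈ t ∙ x)))
  where open Monoid M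

IsMonoidGraph : (V : Set) → (V → V → Set) → Set₁
IsMonoidGraph V Adj =
  Σ (Monoid 0ℓ 0ℓ) λ M →
  Σ (Pred (Monoid.Carrier M) 0ℓ) λ C →
  Σ (Bijection (≡.setoid V) (Monoid.setoid M)) λ f →
    ∀ x y → Adj x y ⇔ CayUAdj M C (Bijection.to f x) (Bijection.to f y)

PetersenVertex : Set
PetersenVertex = GPVertex 5

PetersenAdj : PetersenVertex → PetersenVertex → Set
PetersenAdj = GPAdj 5 2

module Submission where

-- Let ℤ/6 act on ℤ/3 by translation and form the monoid ℤ/6 ⊔ ℤ/3 ⊔ {0} in which
-- g·x is the action, x·g = x, and all other products are 0. Take the generators
-- a = 1 ∈ ℤ/6 and b = 0 ∈ ℤ/3. Right multiplication by a runs around the hexagon ℤ/6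
-- and fixes ℤ/3 (a loop, so no edge), while b joins g ∈ ℤ/6 to g mod 3 ∈ ℤ/3 and each
-- point of ℤ/3 to 0. A hexagon whose opposite vertices share a neighbour, these three
-- neighbours being joined to one further vertex, is the Petersen graph.

open import Defs
open import Level using (Level; 0ℓ)
import Data.Bool.Properties as Bool
open import Data.Empty using (⊥-elim)
open import Data.Fin using (Fin; zero; toℕ)
import Data.Fin.Properties as Fin
open import Data.Fin.Patterns using (0F; 1F; 2F; 3F; 4F; 5F)
open import Data.List using (List; _∷_; [])
open import Data.List.Membership.Propositional using (_∈_; find; lose)
open import Data.List.Relation.Unary.Any using (any?)
open import Data.Nat using (suc; NonZero; _+_; _%_)
open import Data.Nat.Divisibility using (_∣_; divides; ∣-refl)
open import Data.Nat.DivMod using (_mod_; %-distribˡ-+; m∣n⇒o%n%m≡o%m; m<n⇒m%n≡m)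
import Data.Nat.Properties as ℕ
open import Data.Product using (_×_; _,_; ∃-syntax)
open import Data.Sum using (_⊎_; inj₁; inj₂; [_,_])
import Data.Sum.Properties as Sum
open import Function using (const; _∘_)
open import Function.Bundles using (_⇔_; _⤖_; mk⇔; mk↔ₛ′)
open import Function.Properties.Inverse using (↔⇒⤖)
open import Algebra.Bundles using (Monoid)
open import Algebra.Structures using (IsMonoid)
open import Relation.Binary using (Decidable; DecidableEquality)
open import Relation.Binary.PropositionalEquality as ≡
  using (_≡_; refl; cong; cong₂; module ≡-Reasoning)
open import Relation.Nullary using (Dec; yes; no; does; ¬?; _×-dec_; _⊎-dec_; map′)
open import Relation.Nullary.Decidable using (from-yes)
open import Relation.Unary as U using (Pred)

private variable
  a p : Level
  A B : Set a
  P Q : Set p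

%-absorbˡ : ∀ x y {m n} .{{_ : NonZero m}} .{{_ : NonZero n}} → m ∣ n →
            (x % n + y) % m ≡ (x + y) % m
%-absorbˡ x y {m} {n} m∣n = begin
  (x % n + y) % m         ≡⟨ %-distribˡ-+ (x % n) y m ⟩
  (x % n % m + y % m) % m ≡⟨ cong (λ r → (r + y % m) % m) (m∣n⇒o%n%m≡o%m m n x m∣n) ⟩
  (x % m + y % m) % m     ≡⟨ %-distribˡ-+ x y m ⟨
  (x + y) % m             ∎
  where open ≡-Reasoning

%-absorbʳ : ∀ x y {m} .{{_ : NonZero m}} → (x + y % m) % m ≡ (x + y) % m
%-absorbʳ x y {m} = begin
  (x + y % m) % m ≡⟨ cong (_% m) (ℕ.+-comm x (y % m)) ⟩
  (y % m + x) % m ≡⟨ %-absorbˡ y x ∣-refl ⟩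
  (y + x) % m     ≡⟨ cong (_% m) (ℕ.+-comm y x) ⟩
  (x + y) % m     ∎
  where open ≡-Reasoning

-- i ⊕ x is the action of ℤ/n on ℤ/m by translation; it is an action as soon as m ∣ n.
_⊕_ : ∀ {n m} .{{_ : NonZero m}} → Fin n → Fin m → Fin m
_⊕_ {m = m} i x = (toℕ i + toℕ x) mod m

toℕ-⊕ : ∀ {n m} .{{_ : NonZero m}} (i : Fin n) (x : Fin m) →
        toℕ (i ⊕ x) ≡ (toℕ i + toℕ x) % m
toℕ-⊕ i x = Fin.toℕ-fromℕ< _

⊕-assoc : ∀ {n m} .{{_ : NonZero n}} .{{_ : NonZero m}} → m ∣ n →
          (i j : Fin n) (x : Fin m) → (i ⊕ j) ⊕ x ≡ i ⊕ (j ⊕ x)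
⊕-assoc {n} {m} m∣n i j x = Fin.toℕ-injective (begin
  toℕ ((i ⊕ j) ⊕ x)                ≡⟨ toℕ-⊕ (i ⊕ j) x ⟩
  (toℕ (i ⊕ j) + toℕ x) % m        ≡⟨ cong (λ r → (r + toℕ x) % m) (toℕ-⊕ i j) ⟩
  ((toℕ i + toℕ j) % n + toℕ x) % m ≡⟨ %-absorbˡ (toℕ i + toℕ j) (toℕ x) m∣n ⟩
  (toℕ i + toℕ j + toℕ x) % m      ≡⟨ cong (_% m) (ℕ.+-assoc (toℕ i) (toℕ j) (toℕ x)) ⟩
  (toℕ i + (toℕ j + toℕ x)) % m    ≡⟨ %-absorbʳ (toℕ i) (toℕ j + toℕ x) ⟨
  (toℕ i + (toℕ j + toℕ x) % m) % m ≡⟨ cong (λ r → (toℕ i + r) % m) (toℕ-⊕ j x) ⟨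
  (toℕ i + toℕ (j ⊕ x)) % m        ≡⟨ toℕ-⊕ i (j ⊕ x) ⟨
  toℕ (i ⊕ (j ⊕ x))                ∎)
  where open ≡-Reasoning

⊕-identityˡ : ∀ {n m} .{{_ : NonZero m}} (x : Fin m) → zero {n} ⊕ x ≡ x
⊕-identityˡ {n} x = Fin.toℕ-injective (≡.trans (toℕ-⊕ (zero {n}) x) (m<n⇒m%n≡m (Fin.toℕ<n x)))

⊕-identityʳ : ∀ {m} (i : Fin (suc m)) → i ⊕ zero {m} ≡ i
⊕-identityʳ i = Fin.toℕ-injective (begin
  toℕ (i ⊕ zero)        ≡⟨ toℕ-⊕ i zero ⟩
  (toℕ i + 0) % suc _   ≡⟨ cong (_% suc _) (ℕ.+-identityʳ (toℕ i)) ⟩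
  toℕ i % suc _         ≡⟨ m<n⇒m%n≡m (Fin.toℕ<n i) ⟩
  toℕ i                 ∎)
  where open ≡-Reasoning

⊕-isMonoid : ∀ {m} → IsMonoid {A = Fin (suc m)} _≡_ _⊕_ zero
⊕-isMonoid {m} = record
  { isSemigroup = record
    { isMagma = record { isEquivalence = ≡.isEquivalence ; ∙-cong = cong₂ _⊕_ }
    ; assoc = ⊕-assoc ∣-refl }
  ; identity = ⊕-identityˡ {m} , ⊕-identityʳ }

module ZeroExtension {G X : Set} {_·_ : G → G → G} {e : G}
                     (isMonoid : IsMonoid _≡_ _·_ e)
                     (_▷_ : G → X → X)
                     (▷-assoc : ∀ g h x → (g · h) ▷ x ≡ g ▷ (h ▷ x))
                     (▷-identity : ∀ x → e ▷ x ≡ x)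
                     where

  open IsMonoid isMonoid using (assoc; identityˡ; identityʳ)

  data Elem : Set where
    grp  : G → Elem
    pt   : X → Elem
    null : Elem

  infixl 7 _∙_
  _∙_ : Elem → Elem → Elem
  grp g ∙ grp h = grp (g · h)
  grp g ∙ pt x  = pt (g ▷ x)
  grp _ ∙ null  = null
  pt x  ∙ grp _ = pt x
  pt _  ∙ pt _  = null
  pt _  ∙ null  = null
  null  ∙ _     = null

  ∙-assoc : ∀ r s t → (r ∙ s) ∙ t ≡ r ∙ (s ∙ t)
  ∙-assoc (grp g) (grp h) (grp k) = cong grp (assoc g h k)
  ∙-assoc (grp g) (grp h) (pt x)  = cong pt (▷-assoc g h x)
  ∙-assoc (grp g) (grp h) null    = refl
  ∙-assoc (grp g) (pt x)  (grp k) = refl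
  ∙-assoc (grp g) (pt x)  (pt y)  = refl
  ∙-assoc (grp g) (pt x)  null    = refl
  ∙-assoc (grp g) null    t       = refl
  ∙-assoc (pt x)  (grp h) (grp k) = refl
  ∙-assoc (pt x)  (grp h) (pt y)  = refl
  ∙-assoc (pt x)  (grp h) null    = refl
  ∙-assoc (pt x)  (pt y)  (grp k) = refl
  ∙-assoc (pt x)  (pt y)  (pt z)  = refl
  ∙-assoc (pt x)  (pt y)  null    = refl
  ∙-assoc (pt x)  null    t       = refl
  ∙-assoc null    s       t       = refl

  ∙-identityˡ : ∀ s → grp e ∙ s ≡ s
  ∙-identityˡ (grp g) = cong grp (identityˡ g)
  ∙-identityˡ (pt x)  = cong pt (▷-identity x)
  ∙-identityˡ null    = refl

  ∙-identityʳ : ∀ s → s ∙ grp e ≡ s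
  ∙-identityʳ (grp g) = cong grp (identityʳ g)
  ∙-identityʳ (pt x)  = refl
  ∙-identityʳ null    = refl

  monoid : Monoid 0ℓ 0ℓ
  monoid = record
    { Carrier  = Elem
    ; _≈_      = _≡_
    ; _∙_      = _∙_
    ; ε        = grp e
    ; isMonoid = record
      { isSemigroup = record
        { isMagma = record { isEquivalence = ≡.isEquivalence ; ∙-cong = cong₂ _∙_ }
        ; assoc   = ∙-assoc }
      ; identity = ∙-identityˡ , ∙-identityʳ }
    }

  grp-injective : ∀ {g h} → grp g ≡ grp h → g ≡ h
  grp-injective refl = refl

  pt-injective : ∀ {x y} → pt x ≡ pt y → x ≡ y
  pt-injective refl = refl

  module _ (_≟ᴳ_ : DecidableEquality G) (_≟ˣ_ : DecidableEquality X) where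

    infix 4 _≟_
    _≟_ : DecidableEquality Elem
    grp g ≟ grp h = map′ (cong grp) grp-injective (g ≟ᴳ h)
    grp _ ≟ pt _  = no λ ()
    grp _ ≟ null  = no λ ()
    pt _  ≟ grp _ = no λ ()
    pt x  ≟ pt y  = map′ (cong pt) pt-injective (x ≟ˣ y)
    pt _  ≟ null  = no λ ()
    null  ≟ grp _ = no λ ()
    null  ≟ pt _  = no λ ()
    null  ≟ null  = yes refl

  all? : {P : Pred Elem p} →
         Dec (∀ g → P (grp g)) → Dec (∀ x → P (pt x)) → Dec (P null) → Dec (∀ s → P s)
  all? {P = P} onG onX onNull = map′ every (λ ∀P → ∀P ∘ grp , ∀P ∘ pt , ∀P null) (onG ×-dec onX ×-dec onNull)
    where
    every : (∀ g → P (grp g)) × (∀ x → P (pt x)) × P null → ∀ s → P s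
    every (onG , onX , onNull) (grp g) = onG g
    every (onG , onX , onNull) (pt x)  = onX x
    every (onG , onX , onNull) null    = onNull

all?-⊎ : {P : Pred (A ⊎ B) p} →
         Dec (∀ x → P (inj₁ x)) → Dec (∀ y → P (inj₂ y)) → Dec (∀ s → P s)
all?-⊎ onA onB = map′ (λ (f , g) → [ f , g ]) (λ ∀P → ∀P ∘ inj₁ , ∀P ∘ inj₂) (onA ×-dec onB)

⇔-fromDoes : (P? : Dec P) (Q? : Dec Q) → does P? ≡ does Q? → P ⇔ Q
⇔-fromDoes (yes p) (yes q) _ = mk⇔ (const q) (const p)
⇔-fromDoes (no ¬p) (no ¬q) _ = mk⇔ (⊥-elim ∘ ¬p) (⊥-elim ∘ ¬q)

gpAdj? : ∀ n k .{{_ : NonZero n}} → Decidable (GPAdj n k)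
gpAdj? n k (inj₁ i) (inj₁ j) = (toℕ j ℕ.≟ (toℕ i + 1) % n) ⊎-dec (toℕ i ℕ.≟ (toℕ j + 1) % n)
gpAdj? n k (inj₂ i) (inj₂ j) = (toℕ j ℕ.≟ (toℕ i + k) % n) ⊎-dec (toℕ i ℕ.≟ (toℕ j + k) % n)
gpAdj? n k (inj₁ i) (inj₂ j) = i Fin.≟ j
gpAdj? n k (inj₂ i) (inj₁ j) = i Fin.≟ j

cayUAdj? : ∀ {c ℓ} (M : Monoid c ℓ) → Decidable (Monoid._≈_ M) →
           (cs : List (Monoid.Carrier M)) → Decidable (CayUAdj M (_∈ cs))
cayUAdj? M _≈?_ cs s t = ¬? (s ≈? t) ×-dec (arc s t ⊎-dec arc t s)
  where
  open Monoid M using (_≈_; _∙_)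
  arc : ∀ s t → Dec (∃[ x ] (x ∈ cs × t ≈ s ∙ x))
  arc s t = map′ find (λ (_ , x∈cs , t≈sx) → lose x∈cs t≈sx) (any? (λ x → t ≈? (s ∙ x)) cs)

open ZeroExtension (⊕-isMonoid {5}) (_⊕_ {6} {3}) (⊕-assoc (divides 2 refl)) (⊕-identityˡ {5})

_≟ₑ_ : DecidableEquality Elem
_≟ₑ_ = _≟_ Fin._≟_ Fin._≟_

allElem? : {P : Pred Elem p} → U.Decidable P → Dec (∀ s → P s)
allElem? P? = all? (Fin.all? (P? ∘ grp)) (Fin.all? (P? ∘ pt)) (P? null)

allVertex? : {P : Pred PetersenVertex p} → U.Decidable P → Dec (∀ w → P w)
allVertex? P? = all?-⊎ (Fin.all? (P? ∘ inj₁)) (Fin.all? (P? ∘ inj₂))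

pattern u i = inj₁ i
pattern v i = inj₂ i

generators : List Elem
generators = grp 1F ∷ pt 0F ∷ []

-- The hexagon u₀ u₄ v₄ v₁ v₃ v₀ carries 0,…,5 ∈ ℤ/6, the neighbours u₁ u₃ v₂ of u₂
-- carry 0, 1, 2 ∈ ℤ/3, and u₂ is the zero.
toElem : PetersenVertex → Elem
toElem (u 0F) = grp 0F
toElem (u 1F) = pt 0F
toElem (u 2F) = null
toElem (u 3F) = pt 1F
toElem (u 4F) = grp 1F
toElem (v 0F) = grp 5F
toElem (v 1F) = grp 3F
toElem (v 2F) = pt 2F
toElem (v 3F) = grp 4F
toElem (v 4F) = grp 2F

fromElem : Elem → PetersenVertex
fromElem (grp 0F) = u 0F
fromElem (grp 1F) = u 4F
fromElem (grp 2F) = v 4F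
fromElem (grp 3F) = v 1F
fromElem (grp 4F) = v 3F
fromElem (grp 5F) = v 0F
fromElem (pt 0F)  = u 1F
fromElem (pt 1F)  = u 3F
fromElem (pt 2F)  = v 2F
fromElem null     = u 2F

labelling : PetersenVertex ⤖ Elem
labelling = ↔⇒⤖ (mk↔ₛ′ toElem fromElem
  (from-yes (allElem? λ s → toElem (fromElem s) ≟ₑ s))
  (from-yes (allVertex? λ w → Sum.≡-dec Fin._≟_ Fin._≟_ (fromElem (toElem w)) w)))

cayleyAdj? : Decidable (CayUAdj monoid (_∈ generators))
cayleyAdj? = cayUAdj? monoid _≟ₑ_ generators

adjacency-agrees : ∀ x y → does (gpAdj? 5 2 x y) ≡ does (cayleyAdj? (toElem x) (toElem y))
adjacency-agrees = from-yes (allVertex? λ x → allVertex? λ y →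
  does (gpAdj? 5 2 x y) Bool.≟ does (cayleyAdj? (toElem x) (toElem y)))

proposition3p6 : IsMonoidGraph PetersenVertex PetersenAdj
proposition3p6 = monoid , (_∈ generators) , labelling , λ x y →
  ⇔-fromDoes (gpAdj? 5 2 x y) (cayleyAdj? (toElem x) (toElem y)) (adjacency-agrees x y)
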